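{- Let $q$ be a prime power and $k, n\ge k, \tau\le k$ positive integers. If $\vec{B}=(\vec{b}_1;\dots;\vec{b}_k)\in\mathbb{F}_q^{k\times n}$ is a basis of a linear code $\mathcal{C}$ that is fully backward reduced up to $\tau$, then \[\sum_{i=1}^{\tau}\left\lceil\frac{|\vec{b}_1|}{q^{i-1}}\right\rceil\le n-k+\tau.\]
   Context: $|\vec{x}|$ is the Hamming weight, $\mathsf{Supp}(\vec{x})=\{i:x_i\ne0\}$, $\mathsf{Supp}(\mathcal{C})=\bigcup_{\vec{c}\in\mathcal{C}}\mathsf{Supp}(\vec{c})$, and $\mathcal{C}(\vec{B})$ is the row span of $\vec{B}$. $\pi^\perp_{\{\vec{x}_1,\dots,\vec{x}_m\}}$ zeroes all coordinates in $\bigcup_j\mathsf{Supp}(\vec{x}_j)$. For a basis $\vec{B}$ (rows $\vec{b}_i$), $\pi_i:=\pi^\perp_{\{\vec{b}_1,\dots,\vec{b}_{i-1}\}}$, $\vec{b}_i^+:=\pi_i(\vec{b}_i)$, $\vec{B}_{[i,j]}:=(\pi_i(\vec{b}_i);\dots;\pi_i(\vec{b}_j))$. Proper: all $\vec{b}_i^+\ne\vec0$. $S\subseteq[n]$ is redundant for $\mathcal{C}$ if $S\subseteq\mathsf{Supp}(\mathcal{C})$ and for all $\vec{c}\in\mathcal{C}$, $i,j\in S$: $c_i=0\iff c_j=0$; $\eta(\mathcal{C})$ is the maximum size of a redundant set. Backward reduced: proper and $|\vec{b}_k^+|=\eta(\mathcal{C}(\vec{B}))$. Fully backward reduced up to $\tau$: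 proper and $\vec{B}_{[1,i]}$ backward reduced for all $1\le i\le\tau$. -}

module Defs where

open import Level using (Level; _⊔_) renaming (suc to lsuc)
open import Data.Bool using (Bool; true; false; not; if_then_else_)
open import Data.Nat using (ℕ; zero; suc; _+_; _≤_; _^_; _/_)
open import Data.Nat.Primality using (Prime)
open import Data.Fin using (Fin; toℕ; inject≤) renaming (zero to fzero; suc to fsuc)
open import Data.Fin.Subset using (Subset; _∈_; ∣_∣; _∪_; ⊥)
open import Data.Vec using (tabulate; lookup)
open import Data.Product using (Σ; ∃; _×_; _,_)
open import Relation.Nullary using (¬_; Dec; does)
open import Relation.Binary.PropositionalEquality using (_≡_)
open import Algebra.Bundles using (CommutativeRing)

IsPrimePower : ℕ → Set
IsPrimePower q = Σ ℕ λ p → Σ ℕ λ m → Prime p × q ≡ p ^ suc m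

-- ⌈ a / d ⌉ for d ≥ 1 (the value for d = 0 is an irrelevant convention)
ceilDiv : ℕ → ℕ → ℕ
ceilDiv a zero    = 0
ceilDiv a (suc d) = (a + d) / suc d

record FiniteField (c ℓ : Level) (q : ℕ) : Set (lsuc (c ⊔ ℓ)) where
  field
    commRing : CommutativeRing c ℓ
  open CommutativeRing commRing public
  field
    0≉1     : ¬ (0# ≈ 1#)
    inverse : ∀ x → ¬ (x ≈ 0#) → Σ Carrier λ y → (x * y) ≈ 1#
    toFin   : Carrier → Fin q
    fromFin : Fin q → Carrier
    toFin-cong   : ∀ {x y} → x ≈ y → toFin x ≡ toFin y
    toFin-from   : ∀ i → toFin (fromFin i) ≡ i
    from-toFin   : ∀ x → fromFin (toFin x) ≈ x
    -- equality of field elements is decidable (automatic for a finite field;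
    -- included so that supports/Hamming weights can be computed)
    _≟_     : ∀ x y → Dec (x ≈ y)

module Code {c ℓ : Level} {q : ℕ} (F : FiniteField c ℓ q) where
  open FiniteField F renaming (_+_ to _+F_; _*_ to _*F_)

  Vect : ℕ → Set c
  Vect n = Fin n → Carrier

  supp : ∀ {n} → Vect n → Subset n
  supp x = tabulate (λ j → not (does (x j ≟ 0#)))

  wt : ∀ {n} → Vect n → ℕ
  wt x = ∣ supp x ∣

  IsZeroVec : ∀ {n} → Vect n → Set ℓ
  IsZeroVec x = ∀ j → x j ≈ 0#

  ∑ : ∀ k → (Fin k → Carrier) → Carrier
  ∑ zero    f = 0#
  ∑ (suc k) f = f fzero +F ∑ k (λ i → f (fsuc i))

  Mat : ℕ → ℕ → Set c
  Mat k n = Fin k → Vect n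

  lin : ∀ {k n} → (Fin k → Carrier) → Mat k n → Vect n
  lin {k} a B j = ∑ k (λ i → a i *F B i j)

  InSpan : ∀ {k n} → Mat k n → Vect n → Set (c ⊔ ℓ)
  InSpan {k} B x = Σ (Fin k → Carrier) λ a → ∀ j → x j ≈ lin a B j

  LinIndep : ∀ {k n} → Mat k n → Set (c ⊔ ℓ)
  LinIndep {k} B = ∀ (a : Fin k → Carrier) → IsZeroVec (lin a B) → ∀ i → a i ≈ 0#

  unionSupp : ∀ {m n} → Mat m n → Subset n
  unionSupp {zero}  X = ⊥
  unionSupp {suc m} X = supp (X fzero) ∪ unionSupp (λ i → X (fsuc i))

  proj⊥ : ∀ {m n} → Mat m n → Vect n → Vect n
  proj⊥ X x j = if lookup (unionSupp X) j then 0# else x j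

  -- π_i := π^⊥_{b_1,…,b_{i-1}} (rows strictly before row i)
  π : ∀ {k n} → Mat k n → Fin k → Vect n → Vect n
  π {k} B i = proj⊥ (λ (m : Fin (toℕ i)) → B (Data.Fin.inject m))

  bplus : ∀ {k n} → Mat k n → Fin k → Vect n
  bplus B i = π B i (B i)

  Proper : ∀ {k n} → Mat k n → Set ℓ
  Proper {k} B = ∀ (i : Fin k) → ¬ IsZeroVec (bplus B i)

  Redundant : ∀ {k n} → Mat k n → Subset n → Set (c ⊔ ℓ)
  Redundant {k} {n} B S =
    (∀ j → j ∈ S → Σ (Vect n) λ x → InSpan B x × ¬ (x j ≈ 0#))
    × (∀ (x : Vect n) → InSpan B x → ∀ i j → i ∈ S → j ∈ S →
         ((x i ≈ 0# → x j ≈ 0#) × (x j ≈ 0# → x i ≈ 0#)))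

  IsEta : ∀ {k n} → Mat k n → ℕ → Set (c ⊔ ℓ)
  IsEta {k} {n} B e =
    (Σ (Subset n) λ S → Redundant B S × ∣ S ∣ ≡ e)
    × (∀ (S : Subset n) → Redundant B S → ∣ S ∣ ≤ e)

  -- backward reduced (for a matrix with r+1 rows, the last one being b_{r+1})
  BackwardReduced : ∀ {r n} → Mat (suc r) n → Set (c ⊔ ℓ)
  BackwardReduced {r} B = Proper B × IsEta B (wt (bplus B (Data.Fin.fromℕ r)))

  -- B_{[1,i]} = (π_1(b_1);…;π_1(b_i)) = first i rows (π_1 is the identity map)
  prefix : ∀ {k n} → Mat k n → (i : ℕ) → i ≤ k → Mat i n
  prefix B i p = λ m → B (inject≤ m p)

  FullyBackwardReduced : ∀ {k n} → Mat k n → ℕ → Set (c ⊔ ℓ)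
  FullyBackwardReduced {k} B τ =
    Proper B × (∀ r (p : suc r ≤ k) → suc r ≤ τ → BackwardReduced (prefix B (suc r) p))

-- For a matrix M with rows m₀,…,mᵣ, restrict to Supp(m₀) and
-- repeatedly keep the largest class of coordinates j on which the ratio
-- mₗ(j)/m₀(j) of the next row is constant; each step loses at most a factor q.
-- What remains is a set S of size ≥ |m₀|/qʳ on which every row, hence every
-- codeword, is a scalar multiple of m₀, so S is redundant and η ≥ ⌈|m₀|/qʳ⌉.
-- Applied to the backward reduced prefixes B_[1,i+1] this gives
-- ⌈|b₁|/qⁱ⌉ ≤ |b_{i+1}⁺| for i < τ. The supports of the b_i⁺ are pairwise
-- disjoint and nonempty, so Σ_{i≤τ} |b_i⁺| + (k − τ) ≤ Σ_{i≤k} |b_i⁺| ≤ n.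
module Submission where

open import Data.Bool using (Bool; true; false; not; _∧_; _∨_)
open import Data.Empty using (⊥-elim)
open import Data.Fin using (Fin; toℕ; inject; inject≤; fromℕ; fromℕ<)
  renaming (zero to fzero; suc to fsuc)
import Data.Fin as Fin
open import Data.Fin.Properties
  using (¬∀⟶∃¬; nonZeroIndex; toℕ-injective; toℕ-inject; toℕ-inject≤; toℕ-fromℕ; toℕ-fromℕ<; toℕ<n)
open import Data.Fin.Subset using (∣_∣; _∈_)
open import Data.List using (map; upTo; applyUpTo)
open import Data.List.Properties using (map-applyUpTo)
open import Data.Nat using (ℕ; zero; suc; _≤_; _<_; _+_; _*_; _∸_; _^_; z≤n; s≤s; s≤s⁻¹; _≤?_)
open import Data.Nat.DivMod using (m<n*o⇒m/o<n)
open import Data.Nat.ListAction using (sum)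
open import Data.Nat.Properties
  using ( module ≤-Reasoning; ≤-refl; ≤-trans; ≤-reflexive; <⇒≤; ≰⇒>; n<1+n; m<n⇒m<1+n
        ; m≤m+n; m≤n+m; +-mono-≤; +-monoˡ-≤; +-monoʳ-≤; +-mono-≤-<; +-comm; +-assoc
        ; *-comm; *-assoc; *-zeroʳ; *-identityʳ; *-monoˡ-≤; m^n>0
        ; m+n∸n≡m; m∸n+n≡m; ∸-monoˡ-≤; +-∸-comm; +-0-commutativeMonoid)
open import Algebra.Properties.CommutativeMonoid.Sum +-0-commutativeMonoid
  using (sum-syntax; ∑-comm; sum-cong-≗)
open import Data.Product using (∃; _×_; _,_; proj₁; proj₂)
open import Data.Vec using (lookup; tabulate)
open import Data.Vec.Functional using (_∷_)
open import Data.Vec.Properties using (lookup∘tabulate; lookup-zipWith; lookup-replicate; []=⇒lookup)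
open import Function using (_∘_)
open import Level using (Level)
open import Relation.Binary.PropositionalEquality
  using (_≡_; refl; sym; trans; cong; cong₂; subst; subst₂; module ≡-Reasoning)
import Relation.Binary.Reasoning.Setoid
open import Relation.Nullary using (¬_; does; yes; no)
open import Relation.Nullary.Decidable using (dec-true; dec-false)

open import Defs

Bool→ℕ : Bool → ℕ
Bool→ℕ true  = 1
Bool→ℕ false = 0

card : ∀ {n} → (Fin n → Bool) → ℕ
card {n} s = ∑[ j < n ] Bool→ℕ (s j)

∣tabulate∣≡card : ∀ {n} (s : Fin n → Bool) → ∣ tabulate s ∣ ≡ card s
∣tabulate∣≡card {zero}  s = refl
∣tabulate∣≡card {suc n} s with s fzero
... | true  = cong suc (∣tabulate∣≡card (s ∘ fsuc))
... | false = ∣tabulate∣≡card (s ∘ fsuc)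

∈tabulate⇒ : ∀ {n} (s : Fin n → Bool) {j} → j ∈ tabulate s → s j ≡ true
∈tabulate⇒ s {j} j∈s = trans (sym (lookup∘tabulate s j)) ([]=⇒lookup j∈s)

∀-inject⇒∀< : ∀ {k p} (i : Fin k) {P : Fin k → Set p} →
  (∀ (m : Fin (toℕ i)) → P (inject m)) → ∀ m → toℕ m < toℕ i → P m
∀-inject⇒∀< i {P} P∘inject m m<i =
  subst P (toℕ-injective (trans (toℕ-inject (fromℕ< m<i)) (toℕ-fromℕ< m<i))) (P∘inject (fromℕ< m<i))

∀<⇒∀-inject : ∀ {k p} (i : Fin k) {P : Fin k → Set p} →
  (∀ m → toℕ m < toℕ i → P m) → ∀ (m : Fin (toℕ i)) → P (inject m)
∀<⇒∀-inject i P< m = P< (inject m) (subst (_< toℕ i) (sym (toℕ-inject m)) (toℕ<n m))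

∑-mono-≤ : ∀ {m} {f g : Fin m → ℕ} → (∀ i → f i ≤ g i) → ∑[ i < m ] f i ≤ ∑[ i < m ] g i
∑-mono-≤ {zero}  f≤g = z≤n
∑-mono-≤ {suc m} f≤g = +-mono-≤ (f≤g fzero) (∑-mono-≤ (f≤g ∘ fsuc))

f≤∑f : ∀ {m} (f : Fin m → ℕ) i → f i ≤ ∑[ u < m ] f u
f≤∑f f fzero    = m≤m+n (f fzero) _
f≤∑f f (fsuc i) = ≤-trans (f≤∑f (f ∘ fsuc) i) (m≤n+m _ (f fzero))

∑-const : ∀ m c → ∑[ i < m ] c ≡ m * c
∑-const zero    c = refl
∑-const (suc m) c = cong (c +_) (∑-const m c)

∑-zero : ∀ m → ∑[ i < m ] 0 ≡ 0
∑-zero m = trans (∑-const m 0) (*-zeroʳ m)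

sum-map-upTo : ∀ (g : ℕ → ℕ) m → sum (map g (upTo m)) ≡ ∑[ i < m ] g (toℕ i)
sum-map-upTo g m = trans (cong sum (map-applyUpTo (λ i → i) g m)) (sum-applyUpTo g m)
  where
  sum-applyUpTo : ∀ (g : ℕ → ℕ) m → sum (applyUpTo g m) ≡ ∑[ i < m ] g (toℕ i)
  sum-applyUpTo g zero    = refl
  sum-applyUpTo g (suc m) = cong (g 0 +_) (sum-applyUpTo (g ∘ suc) m)

∑-exclusive≤1 : ∀ {m} (b : Fin m → Bool) →
  (∀ i l → toℕ i < toℕ l → b i ≡ true → b l ≡ false) → ∑[ i < m ] Bool→ℕ (b i) ≤ 1
∑-exclusive≤1 {zero}  b exclusive = z≤n
∑-exclusive≤1 {suc m} b exclusive with b fzero in b₀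
... | false = ∑-exclusive≤1 (b ∘ fsuc) (λ i l i<l → exclusive (fsuc i) (fsuc l) (s≤s i<l))
... | true  = ≤-reflexive (cong suc (trans (sum-cong-≗ rest-false) (∑-zero m)))
  where
  rest-false : ∀ l → Bool→ℕ (b (fsuc l)) ≡ 0
  rest-false l rewrite exclusive fzero (fsuc l) (s≤s z≤n) b₀ = refl

∃-maximum : ∀ {m} (c : Fin (suc m) → ℕ) → ∃ λ v → ∀ u → c u ≤ c v
∃-maximum {zero}  c = fzero , λ { fzero → ≤-refl }
∃-maximum {suc m} c with ∃-maximum (c ∘ fsuc)
... | v , max with c fzero ≤? c (fsuc v)
...   | yes c₀≤ = fsuc v , λ { fzero → c₀≤ ; (fsuc u) → max u }
...   | no  c₀≰ = fzero  , λ { fzero → ≤-refl ; (fsuc u) → ≤-trans (max u) (<⇒≤ (≰⇒> c₀≰)) }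

pigeonhole-∑ : ∀ {m} → Fin m → (c : Fin m → ℕ) → ∃ λ v → ∑[ u < m ] c u ≤ m * c v
pigeonhole-∑ {suc m} _ c with ∃-maximum c
... | v , max = v , ≤-trans (∑-mono-≤ max) (≤-reflexive (∑-const (suc m) (c v)))

∑-≟-indicator : ∀ {q} (a : Fin q) → ∑[ v < q ] Bool→ℕ (does (a Fin.≟ v)) ≡ 1
∑-≟-indicator {suc q} fzero    = cong suc (∑-zero q)
∑-≟-indicator         (fsuc a) = ∑-≟-indicator a

∑-card-fibres : ∀ {n q} (s : Fin n → Bool) (g : Fin n → Fin q) →
  ∑[ v < q ] card (λ j → s j ∧ does (g j Fin.≟ v)) ≡ card s
∑-card-fibres {n} {q} s g =
  trans (sym (∑-comm (λ j v → Bool→ℕ (s j ∧ does (g j Fin.≟ v))))) (sum-cong-≗ fibre)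
  where
  fibre : ∀ j → ∑[ v < q ] Bool→ℕ (s j ∧ does (g j Fin.≟ v)) ≡ Bool→ℕ (s j)
  fibre j with s j
  ... | true  = ∑-≟-indicator (g j)
  ... | false = ∑-zero q

ceilDiv-≤ : ∀ {w e d} → 1 ≤ d → w ≤ e * d → ceilDiv w d ≤ e
ceilDiv-≤ {w} {e} {suc d} _ w≤ed = s≤s⁻¹ (m<n*o⇒m/o<n (begin-strict
  w + d             <⟨ +-mono-≤-< w≤ed (n<1+n d) ⟩
  e * suc d + suc d ≡⟨ +-comm (e * suc d) (suc d) ⟩
  suc e * suc d     ∎))
  where open ≤-Reasoning

∑-inject≤+∸≤∑ : ∀ {k} (W : Fin k → ℕ) → (∀ i → 1 ≤ W i) → ∀ {τ} (τ≤k : τ ≤ k) →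
  ∑[ i < τ ] W (inject≤ i τ≤k) + (k ∸ τ) ≤ ∑[ i < k ] W i
∑-inject≤+∸≤∑ {zero}  W W>0 z≤n       = z≤n
∑-inject≤+∸≤∑ {suc k} W W>0 z≤n       =
  +-mono-≤ (W>0 fzero) (∑-inject≤+∸≤∑ (W ∘ fsuc) (W>0 ∘ fsuc) z≤n)
∑-inject≤+∸≤∑ {suc k} W W>0 (s≤s τ≤k) =
  ≤-trans (≤-reflexive (+-assoc (W fzero) _ _))
          (+-monoʳ-≤ (W fzero) (∑-inject≤+∸≤∑ (W ∘ fsuc) (W>0 ∘ fsuc) τ≤k))

+∸≤⇒≤∸+ : ∀ {x k n τ} → τ ≤ k → k ≤ n → x + (k ∸ τ) ≤ n → x ≤ n ∸ k + τ
+∸≤⇒≤∸+ {x} {k} {n} {τ} τ≤k k≤n x+[k∸τ]≤n = begin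
  x             ≡⟨ sym (m+n∸n≡m x k) ⟩
  x + k ∸ k     ≤⟨ ∸-monoˡ-≤ k x+k≤n+τ ⟩
  n + τ ∸ k     ≡⟨ +-∸-comm τ k≤n ⟩
  n ∸ k + τ     ∎
  where
  open ≤-Reasoning
  x+k≤n+τ : x + k ≤ n + τ
  x+k≤n+τ = begin
    x + k             ≡⟨ cong (x +_) (sym (m∸n+n≡m τ≤k)) ⟩
    x + (k ∸ τ + τ)   ≡⟨ sym (+-assoc x (k ∸ τ) τ) ⟩
    x + (k ∸ τ) + τ   ≤⟨ +-monoˡ-≤ τ x+[k∸τ]≤n ⟩
    n + τ             ∎

module ReducedBasis {c ℓ : Level} {q : ℕ} (F : FiniteField c ℓ q) where
  open FiniteField F
    using (Carrier; _≈_; 0#; 1#; _≟_; inverse; toFin; fromFin; from-toFin; setoid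
          ; +-cong; *-cong; zeroˡ; +-identityʳ; distribʳ; *-identityˡ)
    renaming (_+_ to _+F_; _*_ to _*F_; refl to ≈-refl; sym to ≈-sym; trans to ≈-trans
             ; reflexive to ≈-reflexive; *-assoc to *F-assoc; *-comm to *F-comm; *-identityʳ to *F-identityʳ)
  open Code F
  module ≈-Reasoning = Relation.Binary.Reasoning.Setoid setoid

  ∑-cong : ∀ m {f g : Fin m → Carrier} → (∀ i → f i ≈ g i) → ∑ m f ≈ ∑ m g
  ∑-cong zero    f≈g = ≈-refl
  ∑-cong (suc m) f≈g = +-cong (f≈g fzero) (∑-cong m (f≈g ∘ fsuc))

  ∑-*ʳ : ∀ m (f : Fin m → Carrier) y → ∑ m (λ i → f i *F y) ≈ ∑ m f *F y
  ∑-*ʳ zero    f y = ≈-sym (zeroˡ y)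
  ∑-*ʳ (suc m) f y =
    ≈-trans (+-cong ≈-refl (∑-*ʳ m (f ∘ fsuc) y)) (≈-sym (distribʳ y (f fzero) (∑ m (f ∘ fsuc))))

  -- 0# is a junk value for x ≈ 0#; ratios are only taken on the support of x.
  _÷_ : Carrier → Carrier → Carrier
  y ÷ x with x ≟ 0#
  ... | yes _   = 0#
  ... | no x≉0 = y *F proj₁ (inverse x x≉0)

  ÷-*-cancel : ∀ y {x} → ¬ x ≈ 0# → (y ÷ x) *F x ≈ y
  ÷-*-cancel y {x} x≉0 with x ≟ 0#
  ... | yes x≈0 = ⊥-elim (x≉0 x≈0)
  ... | no x≉0 = begin
    (y *F x⁻¹) *F x ≈⟨ *F-assoc y x⁻¹ x ⟩
    y *F (x⁻¹ *F x) ≈⟨ *-cong ≈-refl (≈-trans (*F-comm x⁻¹ x) (proj₂ (inverse x x≉0))) ⟩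
    y *F 1#         ≈⟨ *F-identityʳ y ⟩
    y               ∎
    where
    open ≈-Reasoning
    x⁻¹ : Carrier
    x⁻¹ = proj₁ (inverse x x≉0)

  *≈0⇒≈0 : ∀ {y x} → ¬ x ≈ 0# → y *F x ≈ 0# → y ≈ 0#
  *≈0⇒≈0 {y} {x} x≉0 yx≈0 = begin
    y                ≈⟨ ≈-sym (*F-identityʳ y) ⟩
    y *F 1#          ≈⟨ *-cong ≈-refl (≈-sym (proj₂ (inverse x x≉0))) ⟩
    y *F (x *F x⁻¹)  ≈⟨ ≈-sym (*F-assoc y x x⁻¹) ⟩
    (y *F x) *F x⁻¹  ≈⟨ *-cong yx≈0 ≈-refl ⟩
    0# *F x⁻¹        ≈⟨ zeroˡ x⁻¹ ⟩
    0#               ∎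
    where
    open ≈-Reasoning
    x⁻¹ : Carrier
    x⁻¹ = proj₁ (inverse x x≉0)

  ∑-≈0 : ∀ m {f : Fin m → Carrier} → (∀ i → f i ≈ 0#) → ∑ m f ≈ 0#
  ∑-≈0 zero    f≈0 = ≈-refl
  ∑-≈0 (suc m) f≈0 = ≈-trans (+-cong (f≈0 fzero) (∑-≈0 m (f≈0 ∘ fsuc))) (+-identityʳ 0#)

  isNonzero : Carrier → Bool
  isNonzero y = not (does (y ≟ 0#))

  isNonzero-≉0 : ∀ {y} → ¬ y ≈ 0# → isNonzero y ≡ true
  isNonzero-≉0 {y} y≉0 = cong not (dec-false (y ≟ 0#) y≉0)

  isNonzero-≈0 : ∀ {y} → y ≈ 0# → isNonzero y ≡ false
  isNonzero-≈0 {y} y≈0 = cong not (dec-true (y ≟ 0#) y≈0)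

  isNonzero⇒≉0 : ∀ {y} → isNonzero y ≡ true → ¬ y ≈ 0#
  isNonzero⇒≉0 {y} nz y≈0 with trans (sym nz) (isNonzero-≈0 y≈0)
  ... | ()

  wt≡card : ∀ {n} (x : Vect n) → wt x ≡ card (isNonzero ∘ x)
  wt≡card x = ∣tabulate∣≡card (isNonzero ∘ x)

  wt-mono : ∀ {n} {x y : Vect n} → (∀ j → ¬ x j ≈ 0# → ¬ y j ≈ 0#) → wt x ≤ wt y
  wt-mono {n} {x} {y} supp⊆ = begin
    wt x                                  ≡⟨ wt≡card x ⟩
    ∑[ j < n ] Bool→ℕ (isNonzero (x j))  ≤⟨ ∑-mono-≤ pointwise ⟩
    ∑[ j < n ] Bool→ℕ (isNonzero (y j))  ≡⟨ sym (wt≡card y) ⟩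
    wt y                                  ∎
    where
    open ≤-Reasoning
    pointwise : ∀ j → Bool→ℕ (isNonzero (x j)) ≤ Bool→ℕ (isNonzero (y j))
    pointwise j with x j ≟ 0#
    ... | yes _   = z≤n
    ... | no xj≉0 rewrite isNonzero-≉0 (supp⊆ j xj≉0) = ≤-refl

  ≉0⇒1≤wt : ∀ {n} (x : Vect n) j → ¬ x j ≈ 0# → 1 ≤ wt x
  ≉0⇒1≤wt {n} x j xj≉0 = begin
    1                                    ≡⟨ cong Bool→ℕ (sym (isNonzero-≉0 xj≉0)) ⟩
    Bool→ℕ (isNonzero (x j))            ≤⟨ f≤∑f (λ j → Bool→ℕ (isNonzero (x j))) j ⟩
    ∑[ u < n ] Bool→ℕ (isNonzero (x u))  ≡⟨ sym (wt≡card x) ⟩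
    wt x                                 ∎
    where open ≤-Reasoning

  nonzero⇒1≤wt : ∀ {n} (x : Vect n) → ¬ IsZeroVec x → 1 ≤ wt x
  nonzero⇒1≤wt {n} x x≢0 with ¬∀⟶∃¬ n (λ j → x j ≈ 0#) (λ j → x j ≟ 0#) x≢0
  ... | j , xj≉0 = ≉0⇒1≤wt x j xj≉0

  lookup-unionSupp-suc : ∀ {m n} (X : Mat (suc m) n) j →
    lookup (unionSupp X) j ≡ isNonzero (X fzero j) ∨ lookup (unionSupp (X ∘ fsuc)) j
  lookup-unionSupp-suc X j =
    trans (lookup-zipWith _∨_ j (supp (X fzero)) (unionSupp (X ∘ fsuc)))
          (cong (_∨ lookup (unionSupp (X ∘ fsuc)) j) (lookup∘tabulate (isNonzero ∘ X fzero) j))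

  ∉unionSupp⇒≈0 : ∀ {m n} (X : Mat m n) j → lookup (unionSupp X) j ≡ false → ∀ l → X l j ≈ 0#
  ∉unionSupp⇒≈0 {suc m} X j j∉ l with X fzero j ≟ 0# | lookup-unionSupp-suc X j
  ... | no  _     | eq with trans (sym eq) j∉
  ...   | ()
  ∉unionSupp⇒≈0 {suc m} X j j∉ fzero    | yes X₀j≈0 | _  = X₀j≈0
  ∉unionSupp⇒≈0 {suc m} X j j∉ (fsuc l) | yes _     | eq =
    ∉unionSupp⇒≈0 (X ∘ fsuc) j (trans (sym eq) j∉) l

  ≈0⇒∉unionSupp : ∀ {m n} (X : Mat m n) j → (∀ l → X l j ≈ 0#) → lookup (unionSupp X) j ≡ false
  ≈0⇒∉unionSupp {zero}  X j _     = lookup-replicate j false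
  ≈0⇒∉unionSupp {suc m} X j X·j≈0 = begin
    lookup (unionSupp X) j                                  ≡⟨ lookup-unionSupp-suc X j ⟩
    isNonzero (X fzero j) ∨ lookup (unionSupp (X ∘ fsuc)) j ≡⟨ cong₂ _∨_ (isNonzero-≈0 (X·j≈0 fzero))
                                                                (≈0⇒∉unionSupp (X ∘ fsuc) j (X·j≈0 ∘ fsuc)) ⟩
    false                                                   ∎
    where open ≡-Reasoning

  proj⊥-≉0⇒ : ∀ {m n} (X : Mat m n) (x : Vect n) j →
    ¬ proj⊥ X x j ≈ 0# → ¬ x j ≈ 0# × (∀ l → X l j ≈ 0#)
  proj⊥-≉0⇒ X x j πx≉0 with lookup (unionSupp X) j in j∈?
  ... | true  = ⊥-elim (πx≉0 ≈-refl)
  ... | false = πx≉0 , ∉unionSupp⇒≈0 X j j∈?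

  proj⊥-≉0⇐ : ∀ {m n} (X : Mat m n) (x : Vect n) j →
    ¬ x j ≈ 0# → (∀ l → X l j ≈ 0#) → ¬ proj⊥ X x j ≈ 0#
  proj⊥-≉0⇐ X x j xj≉0 X·j≈0 rewrite ≈0⇒∉unionSupp X j X·j≈0 = xj≉0

  bplus-≉0⇒ : ∀ {k n} (B : Mat k n) i j → ¬ bplus B i j ≈ 0# →
    ¬ B i j ≈ 0# × (∀ m → toℕ m < toℕ i → B m j ≈ 0#)
  bplus-≉0⇒ B i j b⁺≉0 with proj⊥-≉0⇒ (B ∘ inject) (B i) j b⁺≉0
  ... | Bij≉0 , earlier≈0 = Bij≉0 , ∀-inject⇒∀< i earlier≈0

  bplus-≉0⇐ : ∀ {k n} (B : Mat k n) i j →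
    ¬ B i j ≈ 0# → (∀ m → toℕ m < toℕ i → B m j ≈ 0#) → ¬ bplus B i j ≈ 0#
  bplus-≉0⇐ B i j Bij≉0 earlier≈0 = proj⊥-≉0⇐ (B ∘ inject) (B i) j Bij≉0 (∀<⇒∀-inject i earlier≈0)

  bplus-disjoint : ∀ {k n} (B : Mat k n) {i l} j →
    toℕ i < toℕ l → ¬ bplus B i j ≈ 0# → bplus B l j ≈ 0#
  bplus-disjoint B {i} {l} j i<l bᵢ⁺≉0 with bplus B l j ≟ 0#
  ... | yes bₗ⁺≈0 = bₗ⁺≈0
  ... | no  bₗ⁺≉0 =
    ⊥-elim (proj₁ (bplus-≉0⇒ B i j bᵢ⁺≉0) (proj₂ (bplus-≉0⇒ B l j bₗ⁺≉0) i i<l))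

  ∑-wt-bplus≤n : ∀ {k n} (B : Mat k n) → ∑[ i < k ] wt (bplus B i) ≤ n
  ∑-wt-bplus≤n {k} {n} B = begin
    ∑[ i < k ] wt (bplus B i)            ≡⟨ sum-cong-≗ (wt≡card ∘ bplus B) ⟩
    ∑[ i < k ] ∑[ j < n ] nz⁺ i j        ≡⟨ ∑-comm nz⁺ ⟩
    ∑[ j < n ] ∑[ i < k ] nz⁺ i j        ≤⟨ ∑-mono-≤ (λ j → ∑-exclusive≤1 _ (exclusive j)) ⟩
    ∑[ j < n ] 1                         ≡⟨ ∑-const n 1 ⟩
    n * 1                                ≡⟨ *-identityʳ n ⟩
    n                                    ∎
    where
    open ≤-Reasoning
    nz⁺ : Fin k → Fin n → ℕ
    nz⁺ i j = Bool→ℕ (isNonzero (bplus B i j))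
    exclusive : ∀ j i l → toℕ i < toℕ l →
      isNonzero (bplus B i j) ≡ true → isNonzero (bplus B l j) ≡ false
    exclusive j i l i<l = isNonzero-≈0 ∘ bplus-disjoint B j i<l ∘ isNonzero⇒≉0

  wt-bplus-prefix≤ : ∀ {k n} (B : Mat k n) (i : Fin k) →
    wt (bplus (prefix B (suc (toℕ i)) (toℕ<n i)) (fromℕ (toℕ i))) ≤ wt (bplus B i)
  wt-bplus-prefix≤ {n = n} B i = wt-mono λ j b⁺≉0 →
    let Bij≉0 , earlier≈0 = bplus-≉0⇒ B[0,i] (fromℕ (toℕ i)) j b⁺≉0 in
    bplus-≉0⇐ B i j (subst (λ m → ¬ B m j ≈ 0#) last≡i Bij≉0) λ m m<i →
      subst (λ m → B m j ≈ 0#) (inject≤-fromℕ< m<i)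
            (earlier≈0 (fromℕ< (m<n⇒m<1+n m<i)) (fromℕ<-< m<i))
    where
    B[0,i] : Mat (suc (toℕ i)) n
    B[0,i] = prefix B (suc (toℕ i)) (toℕ<n i)
    last≡i : inject≤ (fromℕ (toℕ i)) (toℕ<n i) ≡ i
    last≡i = toℕ-injective (trans (toℕ-inject≤ _ (toℕ<n i)) (toℕ-fromℕ (toℕ i)))
    fromℕ<-< : ∀ {m} (m<i : toℕ m < toℕ i) → toℕ (fromℕ< (m<n⇒m<1+n m<i)) < toℕ (fromℕ (toℕ i))
    fromℕ<-< m<i = subst₂ _<_ (sym (toℕ-fromℕ< _)) (sym (toℕ-fromℕ (toℕ i))) m<i
    inject≤-fromℕ< : ∀ {m} (m<i : toℕ m < toℕ i) → inject≤ (fromℕ< (m<n⇒m<1+n m<i)) (toℕ<n i) ≡ m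
    inject≤-fromℕ< m<i = toℕ-injective (trans (toℕ-inject≤ _ (toℕ<n i)) (toℕ-fromℕ< _))

  proportionalRefinement : ∀ {n} (x y : Vect n) (S : Fin n → Bool) → (∀ j → S j ≡ true → ¬ x j ≈ 0#) →
    ∃ λ (S′ : Fin n → Bool) → ∃ λ a →
      (∀ j → S′ j ≡ true → S j ≡ true) × (∀ j → S′ j ≡ true → y j ≈ a *F x j)
      × card S ≤ q * card S′
  proportionalRefinement {n} x y S S⊆supp = S′ , fromFin v , S′⊆S , proportional , card-bound
    where
    ratio : Fin n → Fin q
    ratio j = toFin (y j ÷ x j)
    fibre : Fin q → Fin n → Bool
    fibre v j = S j ∧ does (ratio j Fin.≟ v)
    largest : ∃ λ v → ∑[ u < q ] card (fibre u) ≤ q * card (fibre v)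
    largest = pigeonhole-∑ (toFin 0#) (card ∘ fibre)
    v : Fin q
    v = proj₁ largest
    S′ : Fin n → Bool
    S′ = fibre v
    S′⊆S : ∀ j → S′ j ≡ true → S j ≡ true
    S′⊆S j S′j with S j
    ... | true = refl
    proportional : ∀ j → S′ j ≡ true → y j ≈ fromFin v *F x j
    proportional j S′j with S j in Sj | ratio j Fin.≟ v
    ... | true | yes ratio≡v = begin
      y j                             ≈⟨ ≈-sym (÷-*-cancel (y j) (S⊆supp j Sj)) ⟩
      (y j ÷ x j) *F x j              ≈⟨ *-cong (≈-sym (from-toFin (y j ÷ x j))) ≈-refl ⟩
      fromFin (ratio j) *F x j        ≈⟨ ≈-reflexive (cong (λ u → fromFin u *F x j) ratio≡v) ⟩
      fromFin v *F x j                ∎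
      where open ≈-Reasoning
    card-bound : card S ≤ q * card S′
    card-bound = ≤-trans (≤-reflexive (sym (∑-card-fibres S ratio))) (proj₂ largest)

  proportionalSubset : ∀ {n} r (x : Vect n) (R : Mat r n) →
    ∃ λ (S : Fin n → Bool) → ∃ λ (α : Fin r → Carrier) →
      (∀ j → S j ≡ true → ¬ x j ≈ 0#) × (∀ l j → S j ≡ true → R l j ≈ α l *F x j)
      × wt x ≤ card S * q ^ r
  proportionalSubset zero x R =
    isNonzero ∘ x , (λ ()) , (λ j → isNonzero⇒≉0) , (λ ()) ,
    ≤-reflexive (trans (wt≡card x) (sym (*-identityʳ _)))
  proportionalSubset (suc r) x R
    with proportionalSubset r x (R ∘ fsuc)
  ... | S , α , S⊆supp , R′∝x , wt≤
    with proportionalRefinement x (R fzero) S S⊆supp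
  ... | S′ , a , S′⊆S , R₀∝x , card≤ =
    S′ , a ∷ α , (λ j → S⊆supp j ∘ S′⊆S j) , R∝x , (begin
      wt x                       ≤⟨ wt≤ ⟩
      card S * q ^ r             ≤⟨ *-monoˡ-≤ (q ^ r) card≤ ⟩
      q * card S′ * q ^ r        ≡⟨ cong (_* q ^ r) (*-comm q (card S′)) ⟩
      card S′ * q * q ^ r        ≡⟨ *-assoc (card S′) q (q ^ r) ⟩
      card S′ * q ^ suc r        ∎)
    where
    open ≤-Reasoning
    R∝x : ∀ l j → S′ j ≡ true → R l j ≈ (a ∷ α) l *F x j
    R∝x fzero    j S′j = R₀∝x j S′j
    R∝x (fsuc l) j S′j = R′∝x l j (S′⊆S j S′j)

  firstRow∈span : ∀ {r n} (M : Mat (suc r) n) → InSpan M (M fzero)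
  firstRow∈span {r} M = 1# ∷ (λ _ → 0#) , λ j → ≈-sym (begin
    1# *F M fzero j +F ∑ r (λ l → 0# *F M (fsuc l) j)
      ≈⟨ +-cong (*-identityˡ _) (∑-≈0 r (λ l → zeroˡ _)) ⟩
    M fzero j +F 0#
      ≈⟨ +-identityʳ _ ⟩
    M fzero j
      ∎)
    where open ≈-Reasoning

  span-proportional : ∀ {r n} (M : Mat r n) (x : Vect n) (β : Fin r → Carrier) (S : Fin n → Bool) →
    (∀ l j → S j ≡ true → M l j ≈ β l *F x j) →
    ∀ {y} → InSpan M y → ∃ λ γ → ∀ j → S j ≡ true → y j ≈ γ *F x j
  span-proportional {r} M x β S M∝x {y} (a , y≈aM) = ∑ r (λ l → a l *F β l) , λ j Sj → begin
    y j                                 ≈⟨ y≈aM j ⟩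
    ∑ r (λ l → a l *F M l j)            ≈⟨ ∑-cong r (λ l → ≈-trans (*-cong ≈-refl (M∝x l j Sj))
                                                                   (≈-sym (*F-assoc (a l) (β l) (x j)))) ⟩
    ∑ r (λ l → (a l *F β l) *F x j)     ≈⟨ ∑-*ʳ r (λ l → a l *F β l) (x j) ⟩
    ∑ r (λ l → a l *F β l) *F x j       ∎
    where open ≈-Reasoning

  proportional⇒Redundant : ∀ {r n} (M : Mat r n) {x : Vect n} (β : Fin r → Carrier) (S : Fin n → Bool) →
    InSpan M x → (∀ j → S j ≡ true → ¬ x j ≈ 0#) → (∀ l j → S j ≡ true → M l j ≈ β l *F x j) →
    Redundant M (tabulate S)
  proportional⇒Redundant M {x} β S x∈span S⊆supp M∝x =
    (λ j j∈S → x , x∈span , S⊆supp j (∈tabulate⇒ S j∈S)) ,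
    (λ y y∈span i j i∈S j∈S → vanish y∈span i∈S j∈S , vanish y∈span j∈S i∈S)
    where
    vanish : ∀ {y} → InSpan M y → ∀ {i j} → i ∈ tabulate S → j ∈ tabulate S → y i ≈ 0# → y j ≈ 0#
    vanish y∈span {i} {j} i∈S j∈S yi≈0 with span-proportional M x β S M∝x y∈span
    ... | γ , y∝x =
      let Si = ∈tabulate⇒ S i∈S
          γ≈0 = *≈0⇒≈0 (S⊆supp i Si) (≈-trans (≈-sym (y∝x i Si)) yi≈0)
      in ≈-trans (y∝x j (∈tabulate⇒ S j∈S)) (≈-trans (*-cong γ≈0 ≈-refl) (zeroˡ (x j)))

  wt≤η*q^r : ∀ {r n} (M : Mat (suc r) n) {e} → IsEta M e → wt (M fzero) ≤ e * q ^ r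
  wt≤η*q^r {r} M {e} (_ , maximal)
    with proportionalSubset r (M fzero) (M ∘ fsuc)
  ... | S , α , S⊆supp , M′∝M₀ , wt≤ = begin
    wt (M fzero)             ≤⟨ wt≤ ⟩
    card S * q ^ r           ≡⟨ cong (_* q ^ r) (sym (∣tabulate∣≡card S)) ⟩
    ∣ tabulate S ∣ * q ^ r   ≤⟨ *-monoˡ-≤ (q ^ r) (maximal (tabulate S) S-redundant) ⟩
    e * q ^ r                ∎
    where
    open ≤-Reasoning
    M∝M₀ : ∀ l j → S j ≡ true → M l j ≈ (1# ∷ α) l *F M fzero j
    M∝M₀ fzero    j _  = ≈-sym (*-identityˡ (M fzero j))
    M∝M₀ (fsuc l) j Sj = M′∝M₀ l j Sj
    S-redundant : Redundant M (tabulate S)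
    S-redundant = proportional⇒Redundant M (1# ∷ α) S (firstRow∈span M) S⊆supp M∝M₀

  1≤q^ : ∀ r → 1 ≤ q ^ r
  1≤q^ = m^n>0 q {{nonZeroIndex (toFin 0#)}}

  ceilDiv-wt≤wt-bplus-last : ∀ {r n} (M : Mat (suc r) n) → BackwardReduced M →
    ceilDiv (wt (M fzero)) (q ^ r) ≤ wt (bplus M (fromℕ r))
  ceilDiv-wt≤wt-bplus-last {r} M (_ , η) = ceilDiv-≤ (1≤q^ r) (wt≤η*q^r M η)

mainTheorem2 : ∀ {c ℓ} (q : ℕ) (F : FiniteField c ℓ q) → IsPrimePower q →
    (k n τ : ℕ) → (0<k : 0 < k) → k ≤ n → 1 ≤ τ → τ ≤ k →
    let open Code F in
    (B : Mat k n) → LinIndep B → FullyBackwardReduced B τ →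
    sum (map (λ i → ceilDiv (wt (B (fromℕ< 0<k))) (q ^ i)) (upTo τ)) ≤ n ∸ k + τ
mainTheorem2 q F _ (suc k) n τ _ k≤n _ τ≤k B _ (proper , prefixes-reduced) =
  subst (_≤ n ∸ suc k + τ) (sym (sum-map-upTo (λ i → ceilDiv w (q ^ i)) τ))
    (+∸≤⇒≤∸+ τ≤k k≤n (begin
      ∑[ i < τ ] ceilDiv w (q ^ toℕ i) + (suc k ∸ τ) ≤⟨ +-monoˡ-≤ (suc k ∸ τ) (∑-mono-≤ ceilDiv≤W) ⟩
      ∑[ i < τ ] W (inject≤ i τ≤k) + (suc k ∸ τ)     ≤⟨ ∑-inject≤+∸≤∑ W W>0 τ≤k ⟩
      ∑[ i < suc k ] W i                             ≤⟨ ∑-wt-bplus≤n B ⟩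
      n                                              ∎))
  where
  open Code F
  open ReducedBasis F
  open ≤-Reasoning
  w : ℕ
  w = wt (B fzero)
  W : Fin (suc k) → ℕ
  W i = wt (bplus B i)
  W>0 : ∀ i → 1 ≤ W i
  W>0 i = nonzero⇒1≤wt (bplus B i) (proper i)
  ceilDiv≤W : ∀ (i : Fin τ) → ceilDiv w (q ^ toℕ i) ≤ W (inject≤ i τ≤k)
  ceilDiv≤W i rewrite sym (toℕ-inject≤ i τ≤k) =
    ≤-trans (ceilDiv-wt≤wt-bplus-last _ (prefixes-reduced (toℕ i′) (toℕ<n i′) i′<τ))
            (wt-bplus-prefix≤ B i′)
    where
    i′ : Fin (suc k)
    i′ = inject≤ i τ≤k
    i′<τ : toℕ i′ < τ
    i′<τ = subst (_< τ) (sym (toℕ-inject≤ i τ≤k)) (toℕ<n i)
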